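{- Let $m\ge 1$. For integers $n\ge 1$ and $k\ge 1$ let $\alpha_{n,k}$ be the number of words of length $n$ on $\{1,\dots,m\}$ that avoid both generalized patterns $1-21$ and $2-12$ and whose set of letters is exactly $\{1,\dots,k\}$. Then for $1\le k\le m$, \[ \alpha_{n,k}=k\cdot (n-1)_{k-1}, \] where $(a)_b=a(a-1)\cdots(a-b+1)$ is the falling factorial (with $(a)_0=1$).
   Context: A word of length $n$ on $\{1,\dots,m\}$ (naturally ordered) is a sequence $w_1\cdots w_n$ of elements of $\{1,\dots,m\}$. A word $w$ contains the generalized pattern $1-21$ iff there exist indices $1\le i<j<n$ with $w_i=w_{j+1}<w_j$, and contains $2-12$ iff there exist $i<j<n$ with $w_i=w_{j+1}>w_j$; it avoids a pattern if it does not contain it. -}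

module Defs where

open import Data.Nat using (ℕ; zero; suc; _*_; _∸_; _<_; _≤_)
open import Data.Fin using (Fin; toℕ)
open import Data.Vec using (Vec; []; _∷_; lookup)
open import Data.List using (List; []; _∷_; map; concatMap; length; filter; allFin)
open import Data.List.Relation.Unary.Any using (Any)
open import Data.Product using (Σ; ∃; _×_; _,_)
open import Relation.Binary.PropositionalEquality using (_≡_)
open import Relation.Nullary using (¬_; Dec)
open import Relation.Unary using (Pred; Decidable)
open import Level using (0ℓ)

falling : ℕ → ℕ → ℕ
falling a zero    = 1
falling a (suc b) = (a ∸ b) * falling a b

-- A word of length n on {1,...,m}: letter i is represented by the element
-- of Fin m with toℕ = i - 1 (order is preserved).
Word : ℕ → ℕ → Set
Word m n = Vec (Fin m) n

-- Position indices 0-based: w contains 1-21 iff there are i < j with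
-- j + 1 < n (so w_{j+1} exists), w_i = w_{j+1} and w_{j+1} < w_j.
Contains1-21 : ∀ {m n} → Word m n → Set
Contains1-21 {m} {n} w =
  Σ (Fin n) λ i → Σ (Fin n) λ j → Σ (Fin n) λ j' →
    (toℕ i < toℕ j) × (toℕ j' ≡ suc (toℕ j)) ×
    (lookup w i ≡ lookup w j') × (toℕ (lookup w j') < toℕ (lookup w j))

Contains2-12 : ∀ {m n} → Word m n → Set
Contains2-12 {m} {n} w =
  Σ (Fin n) λ i → Σ (Fin n) λ j → Σ (Fin n) λ j' →
    (toℕ i < toℕ j) × (toℕ j' ≡ suc (toℕ j)) ×
    (lookup w i ≡ lookup w j') × (toℕ (lookup w j) < toℕ (lookup w j'))

-- The set of letters of w is exactly {1,...,k}
-- (i.e. letters with 0-based index < k).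
LettersExactly : ∀ {m n} → ℕ → Word m n → Set
LettersExactly {m} {n} k w =
  (∀ (p : Fin n) → toℕ (lookup w p) < k) ×
  (∀ (a : Fin m) → toℕ a < k → ∃ λ (p : Fin n) → lookup w p ≡ a)

Good : ∀ (m n k : ℕ) → Word m n → Set
Good m n k w = ¬ Contains1-21 w × ¬ Contains2-12 w × LettersExactly k w

allWords : ∀ m n → List (Word m n)
allWords m zero    = [] ∷ []
allWords m (suc n) = concatMap (λ a → map (a ∷_) (allWords m n)) (allFin m)

countWords : ∀ m n {P : Pred (Word m n) 0ℓ} → Decidable P → ℕ
countWords m n P? = length (filter P? (allWords m n))

module Submission where

-- An occurrence of 1-21 or of 2-12 is the same thing as a letter w_{j+1}
-- that already occurred at some i < j while w_j ≠ w_{j+1}.  So a word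
-- avoids both patterns exactly when every letter occupies one contiguous
-- block; we call such words run-words.
--
-- Reading a run-word a ∷ w from the front, either a repeats the first
-- letter of w (and w is a run-word with the same letter set S), or a does
-- not occur in w (and w is a run-word on S ∖ {a}).  Writing c(n, S) for the
-- number of run-words of length n with letter set exactly S, this gives
--   c(n+1, S) = [n ≥ 1] c(n, S) + Σ_{a ∈ S} c(n, S ∖ {a}),
-- so c(n, S) only depends on s = |S|; it equals runCount n s, and Pascal's
-- rule for falling factorials yields runCount (n+1) s = s · (n)_{s-1}.
--
-- The theorem is the case
-- S = {1,…,k}.

open import Defs
open import Level using (0ℓ)
open import Function using (_∘_; _⇔_; mk⇔; Equivalence)
open import Data.Nat using (ℕ; zero; suc; _+_; _*_; _∸_; _≤_; _<_; z≤n; s≤s)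
open import Data.Nat.Properties
  using ( +-*-semiring; +-identityʳ; *-identityˡ; +-comm; +-assoc; *-zeroʳ; *-comm; *-assoc
        ; *-distribˡ-+; +-∸-assoc; m≤n⇒m∸n≡0; 0∸n≡0; m+[n∸m]≡n; ≰⇒>; <⇒≤
        ; suc-injective; <-irrefl; <-cmp)
  renaming (_≤?_ to _≤ℕ?_)
open import Data.Bool using (Bool; true; false; _∧_; _∨_; not)
open import Data.Bool.Properties
  using (∧-conicalˡ; ∧-conicalʳ; ∨-conicalˡ; ∨-conicalʳ; not-injective)
  renaming (_≟_ to _≟ᵇ_)
open import Data.Fin using (Fin; toℕ) renaming (zero to fzero; suc to fsuc)
open import Data.Fin.Properties using (_≟_; toℕ-injective)
open import Data.Fin.Subset using (Subset; ⊥; ∣_∣)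
open import Data.Vec using ([]; _∷_; lookup; _[_]≔_)
open import Data.Vec.Properties
  using ( ≡-dec; lookup∘update; lookup∘update′; []≔-lookup; []≔-idempotent
        ; lookup-replicate; tabulate∘lookup; tabulate-cong)
open import Data.List as List using (List; []; _∷_; concatMap; length; filter)
open import Data.List.Properties using (map-++; map-tabulate; map-∘)
open import Data.Nat.ListAction using () renaming (sum to sumList)
open import Data.Nat.ListAction.Properties using (sum-++)
open import Data.Product using (Σ; ∃; _×_; _,_)
open import Data.Sum using (_⊎_; inj₁; inj₂)
open import Relation.Binary.PropositionalEquality
open import Relation.Binary.Definitions using (tri<; tri≈; tri>)
open import Relation.Nullary using (¬_; Dec; yes; no; does; contradiction)
open import Relation.Nullary.Decidable using (dec-true; dec-false)
open import Relation.Unary using (Pred; Decidable)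
open import Algebra.Properties.Semiring.Sum +-*-semiring
  using (sum-syntax; sum-cong-≗; sum-replicate-zero; ∑-distrib-+; *-distribˡ-sum; *-distribʳ-sum)

open ≡-Reasoning

𝟙[_] : Bool → ℕ
𝟙[ true  ] = 1
𝟙[ false ] = 0

𝟙-∧ : ∀ x y → 𝟙[ x ∧ y ] ≡ 𝟙[ x ] * 𝟙[ y ]
𝟙-∧ true  y = sym (+-identityʳ 𝟙[ y ])
𝟙-∧ false y = refl

bool-ext : ∀ {x y : Bool} → (x ≡ true → y ≡ true) → (y ≡ true → x ≡ true) → x ≡ y
bool-ext {true}  {true}  _ _ = refl
bool-ext {false} {false} _ _ = refl
bool-ext {true}  {false} x⇒y _ = sym (x⇒y refl)
bool-ext {false} {true}  _ y⇒x = y⇒x refl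

-- Falling factorials.

falling-vanishes : ∀ n t → n < t → falling n t ≡ 0
falling-vanishes n (suc u) (s≤s n≤u) = cong (_* falling n u) (m≤n⇒m∸n≡0 n≤u)

-- (n+1-u)·(n)_u = (1 + (n-u))·(n)_u; for u > n both sides vanish.
falling-top : ∀ n u → (suc n ∸ u) * falling n u ≡ suc (n ∸ u) * falling n u
falling-top n u with u ≤ℕ? n
... | yes u≤n = cong (_* falling n u) (+-∸-assoc 1 u≤n)
... | no u≰n rewrite falling-vanishes n u (≰⇒> u≰n) =
  trans (*-zeroʳ (suc n ∸ u)) (sym (*-zeroʳ (suc (n ∸ u))))

falling-unfold : ∀ n u → (suc n ∸ u) * (u * falling n (u ∸ 1)) ≡ u * falling n u
falling-unfold n zero    = *-zeroʳ (suc n)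
falling-unfold n (suc v) = begin
  (n ∸ v) * (suc v * falling n v)   ≡⟨ sym (*-assoc (n ∸ v) (suc v) _) ⟩
  (n ∸ v) * suc v * falling n v     ≡⟨ cong (_* falling n v) (*-comm (n ∸ v) (suc v)) ⟩
  suc v * (n ∸ v) * falling n v     ≡⟨ *-assoc (suc v) (n ∸ v) _ ⟩
  suc v * ((n ∸ v) * falling n v)   ∎

falling-pascal : ∀ n t → falling (suc n) t ≡ falling n t + t * falling n (t ∸ 1)
falling-pascal n zero    = refl
falling-pascal n (suc u) = begin
  (suc n ∸ u) * falling (suc n) u
    ≡⟨ cong ((suc n ∸ u) *_) (falling-pascal n u) ⟩
  (suc n ∸ u) * (f + u * falling n (u ∸ 1))
    ≡⟨ *-distribˡ-+ (suc n ∸ u) f _ ⟩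
  (suc n ∸ u) * f + (suc n ∸ u) * (u * falling n (u ∸ 1))
    ≡⟨ cong₂ _+_ (falling-top n u) (falling-unfold n u) ⟩
  (f + (n ∸ u) * f) + u * f
    ≡⟨ cong (_+ u * f) (+-comm f ((n ∸ u) * f)) ⟩
  ((n ∸ u) * f + f) + u * f
    ≡⟨ +-assoc ((n ∸ u) * f) f (u * f) ⟩
  (n ∸ u) * f + suc u * f ∎
  where f = falling n u

-- runCount n s counts the words of length n over a fixed set of s letters
-- that use every letter and whose letters form contiguous runs; its
-- recursion mirrors runWords-count below.
runCount : ℕ → ℕ → ℕ
runCount zero          zero    = 1
runCount zero          (suc _) = 0
runCount (suc zero)    s = s * runCount zero (s ∸ 1)
runCount (suc (suc n)) s = runCount (suc n) s + s * runCount (suc n) (s ∸ 1)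

runCount-closed : ∀ n s → runCount (suc n) s ≡ s * falling n (s ∸ 1)
runCount-closed zero    s = cong (s *_) (empty (s ∸ 1))
  where
  empty : ∀ t → runCount zero t ≡ falling zero t
  empty zero    = refl
  empty (suc u) = sym (cong (_* falling zero u) (0∸n≡0 u))
runCount-closed (suc n) s = begin
  runCount (suc n) s + s * runCount (suc n) (s ∸ 1)
    ≡⟨ cong₂ (λ x y → x + s * y) (runCount-closed n s) (runCount-closed n (s ∸ 1)) ⟩
  s * falling n (s ∸ 1) + s * ((s ∸ 1) * falling n (s ∸ 1 ∸ 1))
    ≡⟨ sym (*-distribˡ-+ s _ _) ⟩
  s * (falling n (s ∸ 1) + (s ∸ 1) * falling n (s ∸ 1 ∸ 1))
    ≡⟨ cong (s *_) (sym (falling-pascal n (s ∸ 1))) ⟩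
  s * falling (suc n) (s ∸ 1) ∎

sift : ∀ {m} (a : Fin m) (F : Fin m → ℕ) → ∑[ b < m ] (𝟙[ does (a ≟ b) ] * F b) ≡ F a
sift {suc m} fzero    F = trans (cong₂ _+_ (+-identityʳ (F fzero)) (sum-replicate-zero m))
                                (+-identityʳ (F fzero))
sift {suc m} (fsuc a) F = sift a (F ∘ fsuc)

sumWords : ∀ m n → (Word m n → ℕ) → ℕ
sumWords m zero    f = f []
sumWords m (suc n) f = ∑[ a < m ] sumWords m n (λ w → f (a ∷ w))

sumWords-cong : ∀ m n {f g : Word m n → ℕ} → (∀ w → f w ≡ g w) →
  sumWords m n f ≡ sumWords m n g
sumWords-cong m zero    f≗g = f≗g []
sumWords-cong m (suc n) f≗g = sum-cong-≗ (λ a → sumWords-cong m n (λ w → f≗g (a ∷ w)))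

sumWords-+ : ∀ m n (f g : Word m n → ℕ) →
  sumWords m n (λ w → f w + g w) ≡ sumWords m n f + sumWords m n g
sumWords-+ m zero    f g = refl
sumWords-+ m (suc n) f g =
  trans (sum-cong-≗ (λ a → sumWords-+ m n (λ w → f (a ∷ w)) (λ w → g (a ∷ w))))
        (∑-distrib-+ (λ a → sumWords m n (λ w → f (a ∷ w))) (λ a → sumWords m n (λ w → g (a ∷ w))))

sumWords-*ˡ : ∀ m n c (f : Word m n → ℕ) →
  sumWords m n (λ w → c * f w) ≡ c * sumWords m n f
sumWords-*ˡ m zero    c f = refl
sumWords-*ˡ m (suc n) c f =
  trans (sum-cong-≗ (λ a → sumWords-*ˡ m n c (λ w → f (a ∷ w))))
        (sym (*-distribˡ-sum c (λ a → sumWords m n (λ w → f (a ∷ w)))))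

length-filter : ∀ {A : Set} {P : Pred A 0ℓ} (P? : Decidable P) (xs : List A) →
  length (filter P? xs) ≡ sumList (List.map (λ x → 𝟙[ does (P? x) ]) xs)
length-filter P? []       = refl
length-filter P? (x ∷ xs) with does (P? x)
... | true  = cong suc (length-filter P? xs)
... | false = length-filter P? xs

sum-concatMap : ∀ {A B : Set} (f : B → ℕ) (g : A → List B) (xs : List A) →
  sumList (List.map f (concatMap g xs))
    ≡ sumList (List.map (λ x → sumList (List.map f (g x))) xs)
sum-concatMap f g []       = refl
sum-concatMap f g (x ∷ xs) = begin
  sumList (List.map f (g x List.++ concatMap g xs))
    ≡⟨ cong sumList (map-++ f (g x) _) ⟩
  sumList (List.map f (g x) List.++ List.map f (concatMap g xs))
    ≡⟨ sum-++ (List.map f (g x)) _ ⟩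
  sumList (List.map f (g x)) + sumList (List.map f (concatMap g xs))
    ≡⟨ cong (sumList (List.map f (g x)) +_) (sum-concatMap f g xs) ⟩
  sumList (List.map f (g x)) + sumList (List.map (λ y → sumList (List.map f (g y))) xs) ∎

sum-tabulate : ∀ {m} (h : Fin m → ℕ) → sumList (List.tabulate h) ≡ ∑[ a < m ] h a
sum-tabulate {zero}  h = refl
sum-tabulate {suc m} h = cong (h fzero +_) (sum-tabulate (h ∘ fsuc))

sumWords-allWords : ∀ m n (f : Word m n → ℕ) →
  sumList (List.map f (allWords m n)) ≡ sumWords m n f
sumWords-allWords m zero    f = +-identityʳ (f [])
sumWords-allWords m (suc n) f = begin
  sumList (List.map f (concatMap extend (List.allFin m)))
    ≡⟨ sum-concatMap f extend (List.allFin m) ⟩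
  sumList (List.map (λ a → sumList (List.map f (extend a))) (List.allFin m))
    ≡⟨ cong sumList (map-tabulate (λ a → a) (λ a → sumList (List.map f (extend a)))) ⟩
  sumList (List.tabulate (λ a → sumList (List.map f (extend a))))
    ≡⟨ sum-tabulate (λ a → sumList (List.map f (extend a))) ⟩
  ∑[ a < m ] sumList (List.map f (extend a))
    ≡⟨ sum-cong-≗ (λ a → trans (cong sumList (sym (map-∘ (allWords m n))))
                                (sumWords-allWords m n (λ w → f (a ∷ w)))) ⟩
  sumWords m (suc n) f ∎
  where
  extend : Fin m → List (Word m (suc n))
  extend a = List.map (λ w → a ∷ w) (allWords m n)

countWords-as-sum : ∀ m n {P : Pred (Word m n) 0ℓ} (P? : Decidable P) →
  countWords m n P? ≡ sumWords m n (λ w → 𝟙[ does (P? w) ])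
countWords-as-sum m n P? = trans (length-filter P? (allWords m n)) (sumWords-allWords m n _)

-- Finite sets of letters, as characteristic vectors (Subset m = Vec Bool m).

infix 7 _∈ᵇ_
infix 4 _≟ₛ_

_∈ᵇ_ : ∀ {m} → Fin m → Subset m → Bool
a ∈ᵇ S = lookup S a

insert remove : ∀ {m} → Fin m → Subset m → Subset m
insert a S = S [ a ]≔ true
remove a S = S [ a ]≔ false

_≟ₛ_ : ∀ {m} (S T : Subset m) → Dec (S ≡ T)
_≟ₛ_ = ≡-dec _≟ᵇ_

subset-ext : ∀ {m} {S T : Subset m} → (∀ a → a ∈ᵇ S ≡ a ∈ᵇ T) → S ≡ T
subset-ext {S = S} {T} same =
  trans (sym (tabulate∘lookup S)) (trans (tabulate-cong same) (tabulate∘lookup T))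

∉⊥ : ∀ {m} (a : Fin m) → a ∈ᵇ ⊥ ≡ false
∉⊥ a = lookup-replicate a false

update-current : ∀ {m} {a : Fin m} (S : Subset m) {x} → a ∈ᵇ S ≡ x → S [ a ]≔ x ≡ S
update-current {a = a} S refl = []≔-lookup S a

insert-remove : ∀ {m} {a : Fin m} S → a ∈ᵇ S ≡ true → insert a (remove a S) ≡ S
insert-remove {a = a} S a∈S = trans ([]≔-idempotent S a) (update-current S a∈S)

remove-insert : ∀ {m} {a : Fin m} L → a ∈ᵇ L ≡ false → remove a (insert a L) ≡ L
remove-insert {a = a} L a∉L = trans ([]≔-idempotent L a) (update-current L a∉L)

remove-excludes : ∀ {m} {a : Fin m} L S → a ∈ᵇ L ≡ true → does (L ≟ₛ remove a S) ≡ false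
remove-excludes {a = a} L S a∈L = dec-false (L ≟ₛ remove a S) λ L≡ →
  contradiction (trans (sym a∈L) (trans (cong (a ∈ᵇ_) L≡) (lookup∘update a S false))) λ ()

insert-fresh : ∀ {m} {a : Fin m} L S → a ∈ᵇ L ≡ false →
  does (insert a L ≟ₛ S) ≡ (a ∈ᵇ S ∧ does (L ≟ₛ remove a S))
insert-fresh {a = a} L S a∉L with insert a L ≟ₛ S
... | yes refl = sym (trans (cong (_∧ does (L ≟ₛ remove a (insert a L))) (lookup∘update a L true))
                            (dec-true (L ≟ₛ remove a (insert a L)) (sym (remove-insert L a∉L))))
... | no L∪a≢S with a ∈ᵇ S in a∈S
...   | false = refl
...   | true  = sym (dec-false (L ≟ₛ remove a S)
                      (λ L≡ → L∪a≢S (trans (cong (insert a) L≡) (insert-remove S a∈S))))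

member-size : ∀ {m} {a : Fin m} S → a ∈ᵇ S ≡ true → 1 ≤ ∣ S ∣
member-size {a = fzero}  (true  ∷ S) _   = s≤s z≤n
member-size {a = fsuc a} (true  ∷ S) _   = s≤s z≤n
member-size {a = fsuc a} (false ∷ S) a∈S = member-size S a∈S

size-remove : ∀ {m} {a : Fin m} S → a ∈ᵇ S ≡ true → ∣ remove a S ∣ ≡ ∣ S ∣ ∸ 1
size-remove {a = fzero}  (true  ∷ S) _   = refl
size-remove {a = fsuc a} (false ∷ S) a∈S = size-remove S a∈S
size-remove {a = fsuc a} (true  ∷ S) a∈S =
  trans (cong suc (size-remove S a∈S)) (m+[n∸m]≡n (member-size S a∈S))

sum-members : ∀ {m} (S : Subset m) → ∑[ a < m ] 𝟙[ a ∈ᵇ S ] ≡ ∣ S ∣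
sum-members []          = refl
sum-members (true  ∷ S) = cong suc (sum-members S)
sum-members (false ∷ S) = sum-members S

-- The initial segment {1,…,k} of the alphabet (0-based: letters a with a < k).
initial : ∀ m → ℕ → Subset m
initial zero    k       = []
initial (suc m) zero    = false ∷ initial m zero
initial (suc m) (suc k) = true ∷ initial m k

initial-sound : ∀ {m k} (a : Fin m) → a ∈ᵇ initial m k ≡ true → toℕ a < k
initial-sound {k = suc k} fzero    _   = s≤s z≤n
initial-sound {k = zero}  (fsuc a) a∈I with () ← initial-sound {k = zero} a a∈I
initial-sound {k = suc k} (fsuc a) a∈I = s≤s (initial-sound a a∈I)

initial-complete : ∀ {m k} (a : Fin m) → toℕ a < k → a ∈ᵇ initial m k ≡ true
initial-complete {k = suc k} fzero    _         = refl
initial-complete {k = suc k} (fsuc a) (s≤s a<k) = initial-complete a a<k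

size-initial : ∀ {m k} → k ≤ m → ∣ initial m k ∣ ≡ k
size-initial {zero}  {zero}  _         = refl
size-initial {suc m} {zero}  _         = size-initial {m} {zero} z≤n
size-initial {suc m} {suc k} (s≤s k≤m) = cong suc (size-initial k≤m)

-- Run-words.

letters : ∀ {m n} → Word m n → Subset m
letters []      = ⊥
letters (a ∷ w) = insert a (letters w)

startsWith : ∀ {m n} → Fin m → Word m n → Bool
startsWith a []      = false
startsWith a (b ∷ _) = does (a ≟ b)

-- Every letter forms one contiguous run: a new first letter either repeats
-- the following letter or does not occur later at all.
runs : ∀ {m n} → Word m n → Bool
runs []      = true
runs (a ∷ w) = runs w ∧ (startsWith a w ∨ not (a ∈ᵇ letters w))

insert-keeps : ∀ {m} {a b : Fin m} L → b ∈ᵇ L ≡ true → b ∈ᵇ insert a L ≡ true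
insert-keeps {a = a} {b} L b∈L with b ≟ a
... | yes refl = lookup∘update a L true
... | no  b≢a  = trans (lookup∘update′ b≢a L true) b∈L

letters-complete : ∀ {m n} (w : Word m n) p → lookup w p ∈ᵇ letters w ≡ true
letters-complete (a ∷ w) fzero    = lookup∘update a (letters w) true
letters-complete (a ∷ w) (fsuc p) = insert-keeps (letters w) (letters-complete w p)

letters-sound : ∀ {m n} (w : Word m n) a → a ∈ᵇ letters w ≡ true → ∃ λ p → lookup w p ≡ a
letters-sound []      a a∈ = contradiction (trans (sym a∈) (∉⊥ a)) λ ()
letters-sound (b ∷ w) a a∈ with a ≟ b
... | yes a≡b = fzero , sym a≡b
... | no  a≢b with letters-sound w a (trans (sym (lookup∘update′ a≢b (letters w) true)) a∈)
...   | p , wp≡a = fsuc p , wp≡a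

startsWith-member : ∀ {m n} a (w : Word m n) → startsWith a w ≡ true → a ∈ᵇ letters w ≡ true
startsWith-member a (b ∷ w) starts with a ≟ b
startsWith-member a (b ∷ w) refl | yes refl = lookup∘update a (letters w) true

repeat-is-next : ∀ {m n} a b (u : Word m n) →
  (startsWith a (b ∷ u) ∨ not (a ∈ᵇ letters (b ∷ u))) ≡ true →
  a ∈ᵇ letters (b ∷ u) ≡ true → a ≡ b
repeat-is-next a b u fresh-or-next a∈ with a ≟ b
... | yes a≡b = a≡b
... | no  _   = contradiction (trans (sym fresh-or-next) (cong not a∈)) λ ()

runs-contiguous : ∀ {m n} (w : Word m n) → runs w ≡ true →
  ∀ i j j' → toℕ i ≤ toℕ j → toℕ j' ≡ suc (toℕ j) →
  lookup w i ≡ lookup w j' → lookup w j ≡ lookup w j'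
runs-contiguous (a ∷ v) ok fzero fzero j' _ _ same = same
runs-contiguous (a ∷ v) ok (fsuc i) (fsuc j) (fsuc j') (s≤s i≤j) next same =
  runs-contiguous v (∧-conicalˡ _ _ ok) i j j' i≤j (suc-injective next) same
runs-contiguous (a ∷ []) ok fzero (fsuc ()) _ _ _ _
runs-contiguous (a ∷ b ∷ u) ok fzero (fsuc j) (fsuc j') _ next a≡ =
  runs-contiguous (b ∷ u) (∧-conicalˡ _ _ ok) fzero j j' z≤n (suc-injective next) (trans (sym a≡b) a≡)
  where
  a≡b : a ≡ b
  a≡b = repeat-is-next a b u (∧-conicalʳ _ _ ok)
          (subst (λ x → x ∈ᵇ letters (b ∷ u) ≡ true) (sym a≡) (letters-complete (b ∷ u) j'))

not-starting : ∀ {m n} {a : Fin m} b (v : Word m n) → startsWith a (b ∷ v) ≡ false → b ≢ a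
not-starting {a = a} b v not-start b≡a =
  contradiction (trans (sym (dec-true (a ≟ b) (sym b≡a))) not-start) λ ()

entry-point : ∀ {m n} {a : Fin m} (w : Word m n) p → lookup w p ≡ a → startsWith a w ≡ false →
  Σ (Fin n) λ j → Σ (Fin n) λ j' →
    (toℕ j' ≡ suc (toℕ j)) × (lookup w j' ≡ a) × (lookup w j ≢ a)
entry-point (b ∷ v) fzero b≡a not-start = contradiction b≡a (not-starting b v not-start)
entry-point {a = a} (b ∷ c ∷ u) (fsuc p) cu≡a not-start with a ≟ c
... | yes a≡c = fzero , fsuc fzero , refl , sym a≡c , not-starting b (c ∷ u) not-start
... | no  a≢c with entry-point (c ∷ u) p cu≡a (dec-false (a ≟ c) a≢c)
...   | j , j' , next , l , nl = fsuc j , fsuc j' , cong suc next , l , nl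

-- A run is interrupted: w_{j+1} already occurred at some i < j but w_j ≠ w_{j+1}.
-- This is exactly an occurrence of 1-21 or of 2-12.
Interrupted : ∀ {m n} → Word m n → Set
Interrupted {m} {n} w =
  Σ (Fin n) λ i → Σ (Fin n) λ j → Σ (Fin n) λ j' →
    (toℕ i < toℕ j) × (toℕ j' ≡ suc (toℕ j)) ×
    (lookup w i ≡ lookup w j') × (lookup w j ≢ lookup w j')

interrupted-patterns : ∀ {m n} (w : Word m n) → Interrupted w → Contains1-21 w ⊎ Contains2-12 w
interrupted-patterns w (i , j , j' , i<j , next , same , differ)
  with <-cmp (toℕ (lookup w j')) (toℕ (lookup w j))
... | tri< smaller _ _ = inj₁ (i , j , j' , i<j , next , same , smaller)
... | tri≈ _ equal _   = contradiction (sym (toℕ-injective equal)) differ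
... | tri> _ _ larger  = inj₂ (i , j , j' , i<j , next , same , larger)

1-21-interrupted : ∀ {m n} (w : Word m n) → Contains1-21 w → Interrupted w
1-21-interrupted w (i , j , j' , i<j , next , same , smaller) =
  i , j , j' , i<j , next , same , λ eq → <-irrefl (cong toℕ (sym eq)) smaller

2-12-interrupted : ∀ {m n} (w : Word m n) → Contains2-12 w → Interrupted w
2-12-interrupted w (i , j , j' , i<j , next , same , larger) =
  i , j , j' , i<j , next , same , λ eq → <-irrefl (cong toℕ eq) larger

runs-sound : ∀ {m n} (w : Word m n) → runs w ≡ true → ¬ Interrupted w
runs-sound w ok (i , j , j' , i<j , next , same , differ) =
  differ (runs-contiguous w ok i j j' (<⇒≤ i<j) next same)

runs-complete : ∀ {m n} (w : Word m n) → runs w ≡ false → Interrupted w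
runs-complete (a ∷ v) not-runs with runs v in runs-v
... | false with runs-complete v runs-v
...   | i , j , j' , i<j , next , same , differ =
        fsuc i , fsuc j , fsuc j' , s≤s i<j , cong suc next , same , differ
runs-complete (a ∷ v) not-runs | true
  with letters-sound v a (not-injective (∨-conicalʳ _ _ not-runs))
...   | p , vp≡a with entry-point v p vp≡a (∨-conicalˡ _ _ not-runs)
...     | j , j' , next , l , nl =
          fzero , fsuc j , fsuc j' , s≤s z≤n , cong suc next , sym l , λ eq → nl (trans eq l)

runs⇔avoids : ∀ {m n} (w : Word m n) → runs w ≡ true ⇔ (¬ Contains1-21 w × ¬ Contains2-12 w)
runs⇔avoids w = mk⇔
  (λ ok → (λ c → runs-sound w ok (1-21-interrupted w c)) , (λ c → runs-sound w ok (2-12-interrupted w c)))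
  from
  where
  from : ¬ Contains1-21 w × ¬ Contains2-12 w → runs w ≡ true
  from (avoid₁ , avoid₂) with runs w in runs-w
  ... | true  = refl
  ... | false with interrupted-patterns w (runs-complete w runs-w)
  ...   | inj₁ c = contradiction c avoid₁
  ...   | inj₂ c = contradiction c avoid₂

lettersExactly⇔ : ∀ {m n} k (w : Word m n) → LettersExactly k w ⇔ (letters w ≡ initial m k)
lettersExactly⇔ {m} k w = mk⇔ to from
  where
  to : LettersExactly k w → letters w ≡ initial m k
  to (below , onto) = subset-ext λ a → bool-ext
    (λ a∈w → let (p , wp≡a) = letters-sound w a a∈w
             in initial-complete a (subst (λ x → toℕ x < k) wp≡a (below p)))
    (λ a∈I → let (p , wp≡a) = onto a (initial-sound a a∈I)
             in subst (λ x → x ∈ᵇ letters w ≡ true) wp≡a (letters-complete w p))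
  from : letters w ≡ initial m k → LettersExactly k w
  from eq = (λ p → initial-sound (lookup w p) (trans (sym (cong (lookup w p ∈ᵇ_) eq)) (letters-complete w p)))
          , (λ a a<k → letters-sound w a (trans (cong (a ∈ᵇ_) eq) (initial-complete a a<k)))

isRunWordOn : ∀ {m n} → Subset m → Word m n → Bool
isRunWordOn S w = runs w ∧ does (letters w ≟ₛ S)

good-indicator : ∀ {m n} k (good? : Decidable (Good m n k)) (w : Word m n) →
  𝟙[ does (good? w) ] ≡ 𝟙[ isRunWordOn (initial m k) w ]
good-indicator {m} k good? w with good? w | runs w in runs-w | letters w ≟ₛ initial m k
... | yes (avoid₁ , avoid₂ , exact) | false | _ =
  contradiction (trans (sym (Equivalence.from (runs⇔avoids w) (avoid₁ , avoid₂))) runs-w) λ ()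
... | yes (_ , _ , exact) | true | no wrong = contradiction (Equivalence.to (lettersExactly⇔ k w) exact) wrong
... | yes _ | true | yes _ = refl
... | no _ | true | no _ = refl
... | no _ | false | _ = refl
... | no bad | true | yes eq with Equivalence.to (runs⇔avoids w) runs-w
...   | avoid₁ , avoid₂ = contradiction (avoid₁ , avoid₂ , Equivalence.from (lettersExactly⇔ k w) eq) bad

-- The indicator of "a ∷ w is a run-word on S" in terms of w, for a set L of
-- letters of w: either a repeats the first letter h of w (and then w is a
-- run-word on S), or a ∉ L, a ∈ S and w is a run-word on S ∖ {a}.
cons-indicator : ∀ {m} (a : Fin m) S L (ok h : Bool) → (h ≡ true → a ∈ᵇ L ≡ true) →
  𝟙[ (ok ∧ (h ∨ not (a ∈ᵇ L))) ∧ does (insert a L ≟ₛ S) ]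
    ≡ 𝟙[ h ] * 𝟙[ ok ∧ does (L ≟ₛ S) ] + 𝟙[ a ∈ᵇ S ] * 𝟙[ ok ∧ does (L ≟ₛ remove a S) ]
cons-indicator a S L false h _ = sym (cong₂ _+_ (*-zeroʳ 𝟙[ h ]) (*-zeroʳ 𝟙[ a ∈ᵇ S ]))
cons-indicator a S L true true repeat = begin
  𝟙[ does (insert a L ≟ₛ S) ]
    ≡⟨ cong (λ T → 𝟙[ does (T ≟ₛ S) ]) (update-current L (repeat refl)) ⟩
  𝟙[ does (L ≟ₛ S) ]
    ≡⟨ sym (+-identityʳ _) ⟩
  𝟙[ does (L ≟ₛ S) ] + 0
    ≡⟨ cong₂ _+_ (sym (*-identityˡ _)) (sym (*-zeroʳ 𝟙[ a ∈ᵇ S ])) ⟩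
  1 * 𝟙[ does (L ≟ₛ S) ] + 𝟙[ a ∈ᵇ S ] * 0
    ≡⟨ cong (λ b → 1 * 𝟙[ does (L ≟ₛ S) ] + 𝟙[ a ∈ᵇ S ] * 𝟙[ b ])
            (sym (remove-excludes L S (repeat refl))) ⟩
  1 * 𝟙[ does (L ≟ₛ S) ] + 𝟙[ a ∈ᵇ S ] * 𝟙[ does (L ≟ₛ remove a S) ] ∎
cons-indicator a S L true false _ with a ∈ᵇ L in a∈L
... | true  = sym (trans (cong (λ b → 𝟙[ a ∈ᵇ S ] * 𝟙[ b ]) (remove-excludes L S a∈L))
                        (*-zeroʳ 𝟙[ a ∈ᵇ S ]))
... | false = trans (cong 𝟙[_] (insert-fresh L S a∈L)) (𝟙-∧ (a ∈ᵇ S) _)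

runWord-cons : ∀ {m n} (S : Subset m) a (w : Word m n) →
  𝟙[ isRunWordOn S (a ∷ w) ]
    ≡ 𝟙[ startsWith a w ] * 𝟙[ isRunWordOn S w ] + 𝟙[ a ∈ᵇ S ] * 𝟙[ isRunWordOn (remove a S) w ]
runWord-cons S a w = cons-indicator a S (letters w) (runs w) (startsWith a w) (startsWith-member a w)

runWords-split : ∀ m n (S : Subset m) →
  sumWords m (suc n) (λ w → 𝟙[ isRunWordOn S w ])
    ≡ ∑[ a < m ] sumWords m n (λ w → 𝟙[ startsWith a w ] * 𝟙[ isRunWordOn S w ])
      + ∑[ a < m ] (𝟙[ a ∈ᵇ S ] * sumWords m n (λ w → 𝟙[ isRunWordOn (remove a S) w ]))
runWords-split m n S = trans (sum-cong-≗ split-at) (∑-distrib-+ repeated fresh)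
  where
  repeated fresh : Fin m → ℕ
  repeated a = sumWords m n (λ w → 𝟙[ startsWith a w ] * 𝟙[ isRunWordOn S w ])
  fresh    a = 𝟙[ a ∈ᵇ S ] * sumWords m n (λ w → 𝟙[ isRunWordOn (remove a S) w ])
  split-at : ∀ a → sumWords m n (λ w → 𝟙[ isRunWordOn S (a ∷ w) ]) ≡ repeated a + fresh a
  split-at a = begin
    sumWords m n (λ w → 𝟙[ isRunWordOn S (a ∷ w) ])
      ≡⟨ sumWords-cong m n (runWord-cons S a) ⟩
    sumWords m n (λ w → 𝟙[ startsWith a w ] * 𝟙[ isRunWordOn S w ]
                        + 𝟙[ a ∈ᵇ S ] * 𝟙[ isRunWordOn (remove a S) w ])
      ≡⟨ sumWords-+ m n _ _ ⟩
    repeated a + sumWords m n (λ w → 𝟙[ a ∈ᵇ S ] * 𝟙[ isRunWordOn (remove a S) w ])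
      ≡⟨ cong (repeated a +_) (sumWords-*ˡ m n 𝟙[ a ∈ᵇ S ] _) ⟩
    repeated a + fresh a ∎

sum-startsWith : ∀ m n (f : Word m (suc n) → ℕ) →
  ∑[ a < m ] sumWords m (suc n) (λ w → 𝟙[ startsWith a w ] * f w) ≡ sumWords m (suc n) f
sum-startsWith m n f = sum-cong-≗ λ a → begin
  ∑[ b < m ] sumWords m n (λ v → 𝟙[ does (a ≟ b) ] * f (b ∷ v))
    ≡⟨ sum-cong-≗ (λ b → sumWords-*ˡ m n 𝟙[ does (a ≟ b) ] (λ v → f (b ∷ v))) ⟩
  ∑[ b < m ] (𝟙[ does (a ≟ b) ] * sumWords m n (λ v → f (b ∷ v)))
    ≡⟨ sift a (λ b → sumWords m n (λ v → f (b ∷ v))) ⟩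
  sumWords m n (λ v → f (a ∷ v)) ∎

sum-fresh : ∀ m n (S : Subset m) →
  (∀ T → sumWords m n (λ w → 𝟙[ isRunWordOn T w ]) ≡ runCount n ∣ T ∣) →
  ∑[ a < m ] (𝟙[ a ∈ᵇ S ] * sumWords m n (λ w → 𝟙[ isRunWordOn (remove a S) w ]))
    ≡ ∣ S ∣ * runCount n (∣ S ∣ ∸ 1)
sum-fresh m n S count = begin
  ∑[ a < m ] (𝟙[ a ∈ᵇ S ] * sumWords m n (λ w → 𝟙[ isRunWordOn (remove a S) w ]))
    ≡⟨ sum-cong-≗ per-letter ⟩
  ∑[ a < m ] (𝟙[ a ∈ᵇ S ] * runCount n (∣ S ∣ ∸ 1))
    ≡⟨ sym (*-distribʳ-sum (runCount n (∣ S ∣ ∸ 1)) (λ a → 𝟙[ a ∈ᵇ S ])) ⟩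
  (∑[ a < m ] 𝟙[ a ∈ᵇ S ]) * runCount n (∣ S ∣ ∸ 1)
    ≡⟨ cong (_* runCount n (∣ S ∣ ∸ 1)) (sum-members S) ⟩
  ∣ S ∣ * runCount n (∣ S ∣ ∸ 1) ∎
  where
  per-letter : ∀ a → 𝟙[ a ∈ᵇ S ] * sumWords m n (λ w → 𝟙[ isRunWordOn (remove a S) w ])
                   ≡ 𝟙[ a ∈ᵇ S ] * runCount n (∣ S ∣ ∸ 1)
  per-letter a with a ∈ᵇ S in a∈S
  ... | false = refl
  ... | true  = cong (1 *_) (trans (count (remove a S)) (cong (runCount n) (size-remove S a∈S)))

empty-word-count : ∀ {m} (S : Subset m) → 𝟙[ isRunWordOn S [] ] ≡ runCount zero ∣ S ∣
empty-word-count []          = refl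
empty-word-count (true  ∷ S) = refl
empty-word-count (false ∷ S) = empty-word-count S

runWords-count : ∀ m n (S : Subset m) →
  sumWords m n (λ w → 𝟙[ isRunWordOn S w ]) ≡ runCount n ∣ S ∣
runWords-count m zero          S = empty-word-count S
runWords-count m (suc zero)    S =
  trans (runWords-split m zero S)
        (cong₂ _+_ (sum-replicate-zero m) (sum-fresh m zero S (runWords-count m zero)))
runWords-count m (suc (suc n)) S =
  trans (runWords-split m (suc n) S)
        (cong₂ _+_ (trans (sum-startsWith m n (λ w → 𝟙[ isRunWordOn S w ])) (runWords-count m (suc n) S))
                   (sum-fresh m (suc n) S (runWords-count m (suc n))))

mainTheorem4 : (m : ℕ) → 1 ≤ m → (n k : ℕ) → 1 ≤ n → 1 ≤ k → k ≤ m →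
    (good? : Decidable (Good m n k)) →
    countWords m n good? ≡ k * falling (n ∸ 1) (k ∸ 1)
mainTheorem4 m _ zero    k () _ _ _
mainTheorem4 m _ (suc n) k _  _ k≤m good? = begin
  countWords m (suc n) good?
    ≡⟨ countWords-as-sum m (suc n) good? ⟩
  sumWords m (suc n) (λ w → 𝟙[ does (good? w) ])
    ≡⟨ sumWords-cong m (suc n) (good-indicator k good?) ⟩
  sumWords m (suc n) (λ w → 𝟙[ isRunWordOn (initial m k) w ])
    ≡⟨ runWords-count m (suc n) (initial m k) ⟩
  runCount (suc n) ∣ initial m k ∣
    ≡⟨ cong (runCount (suc n)) (size-initial k≤m) ⟩
  runCount (suc n) k
    ≡⟨ runCount-closed n k ⟩
  k * falling n (k ∸ 1) ∎
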